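{- For all positive integers $n,k$: (i) $M(k,n+1)\geq M(k,n)+1$ if $k\leq\binom{n}{2}$; (ii) $M(k+1,n)\geq M(k,n)+1/3$ if $k<\binom{n}{2}$.
   Context: For a finite graph $G$, $\mathrm{Mad}(G)=\max\{2e(H)/|V(H)| : H\subseteq G,\ |V(H)|\geq 1\}$ ($0$ if edgeless). For $1\leq k\leq\binom{n}{2}$, $M(k,n)$ is the maximum of $\sum_{i=1}^k\mathrm{Mad}(G_i)$ over all partitions of $E(K_n)$ into $k$ spanning subgraphs $G_1,\dots,G_k$. -}

module Defs where

open import Data.Bool using (Bool; true; false; _∧_; _∨_; if_then_else_)
open import Data.Nat as ℕ using (ℕ; zero; suc; _*_)
open import Data.Fin using (Fin; toℕ) renaming (_≟_ to _≟F_)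
open import Data.Fin.Subset using (Subset; ∣_∣)
open import Data.List using (List; []; _∷_; _++_; map; concatMap; filterᵇ; length; foldr; zip; allFin)
open import Data.Bool.ListAction using (any; all)
open import Data.Vec using (Vec; lookup) renaming ([] to []ᵛ; _∷_ to _∷ᵛ_)
open import Data.Product using (_×_; _,_; proj₁; proj₂)
open import Data.Integer using (+_)
open import Data.Rational using (ℚ; 0ℚ; _/_; _⊔_; _+_)
open import Relation.Nullary.Decidable using (⌊_⌋)

-- Vertices of K_n are Fin n; an edge is a pair (i , j) with i < j.
Edge : ℕ → Set
Edge n = Fin n × Fin n

edgesK : (n : ℕ) → List (Edge n)
edgesK n = concatMap (λ i → map (λ j → (i , j)) (filterᵇ (λ j → toℕ i ℕ.<ᵇ toℕ j) (allFin n))) (allFin n)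

-- A (spanning) graph on Fin n is given by its list of edges (a sublist of edgesK n).
Graph : ℕ → Set
Graph n = List (Edge n)

sublists : {A : Set} → List A → List (List A)
sublists [] = [] ∷ []
sublists (x ∷ xs) = map (x ∷_) (sublists xs) ++ sublists xs

allSubsets : (n : ℕ) → List (Subset n)
allSubsets zero = []ᵛ ∷ []
allSubsets (suc n) = map (true ∷ᵛ_) (allSubsets n) ++ map (false ∷ᵛ_) (allSubsets n)

nonemptyᵇ : ℕ → Bool
nonemptyᵇ zero = false
nonemptyᵇ (suc _) = true

-- 2e/v as a rational (v = 0 never occurs below, since vertex sets are nonempty).
density : ℕ → ℕ → ℚ
density e zero = 0ℚ
density e (suc v) = (+ (2 * e)) / suc v

-- Maximum of a list of rationals (0 for the empty list; all values used are ≥ 0).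
maxℚ : List ℚ → ℚ
maxℚ = foldr _⊔_ 0ℚ

sumℚ : List ℚ → ℚ
sumℚ = foldr _+_ 0ℚ

insideᵇ : {n : ℕ} → Subset n → Edge n → Bool
insideᵇ S (i , j) = lookup S i ∧ lookup S j

-- All subgraphs H ⊆ G with at least one vertex: a nonempty vertex set S together with
-- a set F of edges of G having both endpoints in S. Its density is 2|F|/|S|.
subgraphDensities : {n : ℕ} → Graph n → List ℚ
subgraphDensities {n} G =
  concatMap (λ S → map (λ F → density (length F) ∣ S ∣)
                         (sublists (filterᵇ (insideᵇ S) G)))
            (filterᵇ (λ S → nonemptyᵇ ∣ S ∣) (allSubsets n))

-- Mad(G) = max { 2 e(H) / |V(H)| : H ⊆ G, |V(H)| ≥ 1 }  (0 if edgeless).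
Mad : {n : ℕ} → Graph n → ℚ
Mad G = maxℚ (subgraphDensities G)

allWords : (k m : ℕ) → List (List (Fin k))
allWords k zero = [] ∷ []
allWords k (suc m) = concatMap (λ c → map (c ∷_) (allWords k m)) (allFin k)

-- A partition of E(K_n) into k (nonempty) spanning subgraphs is a colouring of the
-- edges of K_n by Fin k using every colour; colour class c is G_c.
-- colours : the colour of the t-th edge of edgesK n (a list of length |E(K_n)|)
record Colouring (k n : ℕ) : Set where
  constructor colouring
  field colours : List (Fin k)
open Colouring public

colourClass : {k n : ℕ} → Colouring k n → Fin k → Graph n
colourClass {k} {n} col c = map proj₁ (filterᵇ (λ p → ⌊ proj₂ p ≟F c ⌋) (zip (edgesK n) (colours col)))

surjectiveᵇ : {k n : ℕ} → Colouring k n → Bool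
surjectiveᵇ {k} col = all (λ c → any (λ d → ⌊ d ≟F c ⌋) (colours col)) (allFin k)

partitions : (k n : ℕ) → List (Colouring k n)
partitions k n = filterᵇ surjectiveᵇ (map colouring (allWords k (length (edgesK n))))

M : ℕ → ℕ → ℚ
M k n = maxℚ (map (λ col → sumℚ (map (λ c → Mad (colourClass col c)) (allFin k))) (partitions k n))

{-# OPTIONS --safe #-}
-- (i) Join a new vertex to every old vertex by edges of colour 0. If S is a densest vertex set of
-- the colour-0 class G, adding the new vertex to S adds |S| edges; as G has at most |S|(|S|-1)/2
-- edges inside S, this raises the density by at least 1, and the other classes keep their Mad.
-- (ii) If k < C(n,2), by pigeonhole some class G has two edges; move one edge e of G into a new
-- class, whose Mad is 1. If Mad G ≤ 1 any e will do, since G - e keeps an edge. Otherwise a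
-- densest set S of G has at least 3 vertices (on at most 2 vertices the density is at most 1), and
-- for e inside S the density of S drops by 2/|S| ≤ 2/3, so Mad drops by at most 2/3.
-- In both cases every partition is improved by the stated amount, and hence so is the maximum M.
module Submission where

open import Algebra using (CommutativeMonoid)
open import Data.Bool using (Bool; true; false; T)
open import Data.Bool.ListAction using (any)
open import Data.Empty using (⊥-elim)
open import Data.Fin using (Fin; zero; suc; toℕ; _≟_)
open import Data.Fin.Properties using (suc-injective; pigeonhole)
open import Data.Fin.Subset using (Subset; ∣_∣; ⁅_⁆; _∪_; inside; outside)
open import Data.Fin.Subset.Properties using (x∈⁅x⁆; x∈p∪q⁺; ∣⁅x⁆∣≡1; ∣p∣≤∣p∪q∣)
open import Data.Integer as ℤ using (+_; +≤+)
import Data.Integer.Properties as ℤ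
import Data.List as List
open import Data.List
  using (List; []; _∷_; [_]; _++_; map; filterᵇ; length; concatMap; allFin; zip; replicate)
open import Data.List.Membership.Propositional using (_∈_; lose; find)
open import Data.List.Membership.Propositional.Properties
  using (∈-map⁺; ∈-map⁻; ∈-++⁺ˡ; ∈-++⁺ʳ; ∈-++⁻; ∈-concatMap⁺; ∈-concatMap⁻; ∈-filter⁺; ∈-filter⁻;
         ∈-allFin; ∈-lookup; ∈-length; ∈-∃++; foldr-selective)
open import Data.List.Properties
  using (map-∘; map-id; map-cong; map-++; map-tabulate; length-map; length-++; length-++-sucʳ;
         length-tabulate; length-replicate; filter-++; filter-all; filter-none; filter-some;
         filter-accept; filter-reject; concatMap-map; concatMap-cong; map-concatMap; foldr-preservesʳ)
open import Data.List.Relation.Binary.Sublist.Propositional using (_⊆_)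
open import Data.List.Relation.Binary.Sublist.Propositional.Properties
  using (filter⁺; filter-⊆; length-mono-≤) renaming (map⁺ to ⊆-map⁺)
import Data.List.Relation.Unary.All as All
open import Data.List.Relation.Unary.All.Properties using (all⁺; all⁻)
open import Data.List.Relation.Unary.Any as Any using (here; there)
open import Data.List.Relation.Unary.Any.Properties using (any⁺; any⁻)
open import Data.Nat as ℕ using (ℕ; zero; suc; z≤n; s≤s)
import Data.Nat.Properties as ℕ
open import Data.Nat.Combinatorics using (_C_; nC1≡n; nCk+nC[k+1]≡[n+1]C[k+1])
open import Data.Nat.Tactic.RingSolver using (solve)
open import Data.Product as Product using (_×_; _,_; proj₁; proj₂; ∃-syntax)
open import Data.Rational using (ℚ; 0ℚ; 1ℚ; _/_; _+_; _≤_; _⊔_; toℚᵘ)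
open import Data.Rational.Properties
  using (≤-refl; ≤-trans; ≤-reflexive; p≤p⊔q; p≤q⊔p; ⊔-sel; +-mono-≤; +-monoˡ-≤; +-monoʳ-≤;
         +-identityʳ; +-assoc; +-comm; +-0-commutativeMonoid; module ≤-Reasoning;
         toℚᵘ-cancel-≤; toℚᵘ-injective; toℚᵘ-fromℚᵘ; toℚᵘ-homo-+)
open import Data.Rational.Unnormalised as ℚᵘ using (mkℚᵘ; *≤*; _≃_)
import Data.Rational.Unnormalised.Properties as ℚᵘ
open import Data.Sum using (_⊎_; inj₁; inj₂)
open import Data.Unit using (tt)
open import Data.Vec using (lookup) renaming ([] to []ᵛ; _∷_ to _∷ᵛ_)
open import Data.Vec.Properties using ([]=⇒lookup)
open import Function using (_∘_; id; _⇔_; mk⇔; Equivalence)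
open import Relation.Binary.PropositionalEquality
  using (_≡_; _≢_; refl; sym; trans; cong; cong₂; subst; subst₂; module ≡-Reasoning)
open import Relation.Nullary using (yes; no)
open import Relation.Nullary.Decidable using (T?; ⌊_⌋; toWitness; fromWitness)
open import Defs

filterᵇ-map : ∀ {A B : Set} (p : B → Bool) (f : A → B) xs →
              filterᵇ p (map f xs) ≡ map f (filterᵇ (p ∘ f) xs)
filterᵇ-map p f []       = refl
filterᵇ-map p f (x ∷ xs) with p (f x)
... | true  = cong (f x ∷_) (filterᵇ-map p f xs)
... | false = filterᵇ-map p f xs

allFin-suc : ∀ {n} → allFin (suc n) ≡ zero ∷ map suc (allFin n)
allFin-suc = cong (zero ∷_) (sym (map-tabulate id suc))

nonempty⇒∈ : ∀ {A : Set} (xs : List A) → 0 ℕ.< length xs → ∃[ x ] x ∈ xs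
nonempty⇒∈ (x ∷ _) _ = x , here refl

∈-sublists-self : ∀ {A : Set} (xs : List A) → xs ∈ sublists xs
∈-sublists-self []       = here refl
∈-sublists-self (x ∷ xs) = ∈-++⁺ˡ (∈-map⁺ (x ∷_) (∈-sublists-self xs))

length-∈-sublists : ∀ {A : Set} (xs : List A) {ys} → ys ∈ sublists xs → length ys ℕ.≤ length xs
length-∈-sublists []       (here refl) = z≤n
length-∈-sublists (x ∷ xs) ys∈ with ∈-++⁻ (map (x ∷_) (sublists xs)) ys∈
... | inj₁ ys∈x∷ with ∈-map⁻ (x ∷_) ys∈x∷
...   | _ , zs∈ , refl = s≤s (length-∈-sublists xs zs∈)
length-∈-sublists (x ∷ xs) ys∈ | inj₂ ys∈′ = ℕ.m≤n⇒m≤1+n (length-∈-sublists xs ys∈′)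

zip-map-proj : ∀ {A B : Set} (L : List (A × B)) → zip (map proj₁ L) (map proj₂ L) ≡ L
zip-map-proj []      = refl
zip-map-proj (p ∷ L) = cong (p ∷_) (zip-map-proj L)

map-proj₁-zip : ∀ {A B : Set} (xs : List A) (ys : List B) → length xs ≡ length ys →
                map proj₁ (zip xs ys) ≡ xs
map-proj₁-zip []       []       _  = refl
map-proj₁-zip (x ∷ xs) (y ∷ ys) eq = cong (x ∷_) (map-proj₁-zip xs ys (ℕ.suc-injective eq))

map-proj₂-zip : ∀ {A B : Set} (xs : List A) (ys : List B) → length xs ≡ length ys →
                map proj₂ (zip xs ys) ≡ ys
map-proj₂-zip []       []       _  = refl
map-proj₂-zip (x ∷ xs) (y ∷ ys) eq = cong (y ∷_) (map-proj₂-zip xs ys (ℕ.suc-injective eq))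

map-proj₁-map₁ : ∀ {A B C : Set} (f : A → B) (L : List (A × C)) →
                 map proj₁ (map (Product.map₁ f) L) ≡ map f (map proj₁ L)
map-proj₁-map₁ f L = trans (sym (map-∘ L)) (map-∘ L)

map-proj₁-map₂ : ∀ {A B C : Set} (f : B → C) (L : List (A × B)) →
                 map proj₁ (map (Product.map₂ f) L) ≡ map proj₁ L
map-proj₁-map₂ f []      = refl
map-proj₁-map₂ f (p ∷ L) = cong (proj₁ p ∷_) (map-proj₁-map₂ f L)

map-proj₁-map-pair : ∀ {A B : Set} (b : B) (xs : List A) → map proj₁ (map (_, b) xs) ≡ xs
map-proj₁-map-pair b xs = trans (sym (map-∘ xs)) (map-id xs)

≤-maxℚ : ∀ {x xs} → x ∈ xs → x ≤ maxℚ xs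
≤-maxℚ {xs = y ∷ xs} (here refl)  = p≤p⊔q y (maxℚ xs)
≤-maxℚ {xs = y ∷ xs} (there x∈xs) = ≤-trans (≤-maxℚ x∈xs) (p≤q⊔p y (maxℚ xs))

0≤maxℚ : ∀ xs → 0ℚ ≤ maxℚ xs
0≤maxℚ = foldr-preservesʳ {P = 0ℚ ≤_} {f = _⊔_} (λ x 0≤y → ≤-trans 0≤y (p≤q⊔p x _)) ≤-refl

maxℚ-sel : ∀ xs → maxℚ xs ≡ 0ℚ ⊎ maxℚ xs ∈ xs
maxℚ-sel = foldr-selective ⊔-sel 0ℚ

toℚᵘ-/ : ∀ a b → toℚᵘ (+ a / suc b) ≃ mkℚᵘ (+ a) b
toℚᵘ-/ a b = toℚᵘ-fromℚᵘ (mkℚᵘ (+ a) b)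

a/b≤c/d : ∀ a b c d → a ℕ.* suc d ℕ.≤ c ℕ.* suc b → + a / suc b ≤ + c / suc d
a/b≤c/d a b c d ad≤cb = toℚᵘ-cancel-≤
  (ℚᵘ.≤-respˡ-≃ (ℚᵘ.≃-sym (toℚᵘ-/ a b)) (ℚᵘ.≤-respʳ-≃ (ℚᵘ.≃-sym (toℚᵘ-/ c d))
    (*≤* (subst₂ ℤ._≤_ (ℤ.pos-* a (suc d)) (ℤ.pos-* c (suc b)) (+≤+ ad≤cb)))))

a/b+c/d : ∀ a b c d →
          + a / suc b + + c / suc d ≡ + (a ℕ.* suc d ℕ.+ c ℕ.* suc b) / (suc b ℕ.* suc d)
a/b+c/d a b c d = toℚᵘ-injective (begin
  toℚᵘ (+ a / suc b + + c / suc d)             ≈⟨ toℚᵘ-homo-+ (+ a / suc b) (+ c / suc d) ⟩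
  toℚᵘ (+ a / suc b) ℚᵘ.+ toℚᵘ (+ c / suc d)   ≈⟨ ℚᵘ.+-cong (toℚᵘ-/ a b) (toℚᵘ-/ c d) ⟩
  mkℚᵘ (+ a) b ℚᵘ.+ mkℚᵘ (+ c) d               ≡⟨ cong (λ x → mkℚᵘ x _) numerator ⟩
  mkℚᵘ (+ (a ℕ.* suc d ℕ.+ c ℕ.* suc b)) _     ≈⟨ ℚᵘ.≃-sym (toℚᵘ-/ _ _) ⟩
  toℚᵘ (+ (a ℕ.* suc d ℕ.+ c ℕ.* suc b) / (suc b ℕ.* suc d)) ∎)
  where
  open ℚᵘ.≃-Reasoning
  numerator : + a ℤ.* + suc d ℤ.+ + c ℤ.* + suc b ≡ + (a ℕ.* suc d ℕ.+ c ℕ.* suc b)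
  numerator = trans (cong₂ ℤ._+_ (sym (ℤ.pos-* a (suc d))) (sym (ℤ.pos-* c (suc b))))
                    (sym (ℤ.pos-+ (a ℕ.* suc d) (c ℕ.* suc b)))

-- e ≤ s(s-1)/2 with the division cleared: e edges fit into a complete graph on s vertices.
FitsInK : ℕ → ℕ → Set
FitsInK e s = 2 ℕ.* e ℕ.+ s ℕ.≤ s ℕ.* s

FitsInK-cone : ∀ {e s} → FitsInK e s → FitsInK (s ℕ.+ e) (suc s)
FitsInK-cone {e} {s} fits = begin
  2 ℕ.* (s ℕ.+ e) ℕ.+ suc s           ≡⟨ solve (e ∷ s ∷ []) ⟩
  (2 ℕ.* e ℕ.+ s) ℕ.+ (1 ℕ.+ 2 ℕ.* s) ≤⟨ ℕ.+-monoˡ-≤ _ fits ⟩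
  s ℕ.* s ℕ.+ (1 ℕ.+ 2 ℕ.* s)         ≡⟨ solve (e ∷ s ∷ []) ⟩
  suc s ℕ.* suc s                     ∎
  where open ℕ.≤-Reasoning

FitsInK-≤2 : ∀ {e s} → FitsInK e s → s ℕ.≤ 2 → 2 ℕ.* e ℕ.≤ s
FitsInK-≤2 {e} {s} fits s≤2 = ℕ.+-cancelʳ-≤ s (2 ℕ.* e) s (begin
  2 ℕ.* e ℕ.+ s   ≤⟨ fits ⟩
  s ℕ.* s         ≤⟨ ℕ.*-monoˡ-≤ s s≤2 ⟩
  2 ℕ.* s         ≡⟨ solve (s ∷ []) ⟩
  s ℕ.+ s         ∎)
  where open ℕ.≤-Reasoning

density-mono : ∀ {e e′} s → e ℕ.≤ e′ → density e s ≤ density e′ s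
density-mono          zero    _    = ≤-refl
density-mono {e} {e′} (suc s) e≤e′ =
  a/b≤c/d (2 ℕ.* e) s (2 ℕ.* e′) s (ℕ.*-monoˡ-≤ (suc s) (ℕ.*-monoʳ-≤ 2 e≤e′))

1≤density : ∀ {e s} → 0 ℕ.< s → s ℕ.≤ 2 ℕ.* e → 1ℚ ≤ density e s
1≤density {e} {suc s} _ s≤2e = a/b≤c/d 1 0 (2 ℕ.* e) s
  (subst₂ ℕ._≤_ (sym (ℕ.*-identityˡ (suc s))) (sym (ℕ.*-identityʳ (2 ℕ.* e))) s≤2e)

density≤1 : ∀ {e s} → 2 ℕ.* e ℕ.≤ s → density e s ≤ 1ℚ
density≤1 {e} {zero}  _    = a/b≤c/d 0 0 1 0 z≤n
density≤1 {e} {suc s} 2e≤s = a/b≤c/d (2 ℕ.* e) s 1 0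
  (subst₂ ℕ._≤_ (sym (ℕ.*-identityʳ (2 ℕ.* e))) (sym (ℕ.*-identityˡ (suc s))) 2e≤s)

density-cone : ∀ {e s} → 0 ℕ.< s → FitsInK e s → density e s + 1ℚ ≤ density (s ℕ.+ e) (suc s)
density-cone {e} {s@(suc t)} _ fits rewrite a/b+c/d (2 ℕ.* e) t 1 0 =
  a/b≤c/d (2 ℕ.* e ℕ.* 1 ℕ.+ 1 ℕ.* s) (t ℕ.* 1) (2 ℕ.* (s ℕ.+ e)) s (begin
    (2 ℕ.* e ℕ.* 1 ℕ.+ 1 ℕ.* s) ℕ.* suc s     ≡⟨ solve (e ∷ t ∷ []) ⟩
    (2 ℕ.* e ℕ.+ s) ℕ.+ s ℕ.* (2 ℕ.* e ℕ.+ s) ≤⟨ ℕ.+-monoˡ-≤ _ fits ⟩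
    s ℕ.* s ℕ.+ s ℕ.* (2 ℕ.* e ℕ.+ s)         ≡⟨ solve (e ∷ t ∷ []) ⟩
    2 ℕ.* (s ℕ.+ e) ℕ.* (s ℕ.* 1)             ∎)
  where open ℕ.≤-Reasoning

density-suc≤ : ∀ {e s} → 3 ℕ.≤ s → density (suc e) s ≤ density e s + + 2 / 3
density-suc≤ {e} {s@(suc t)} 3≤s rewrite a/b+c/d (2 ℕ.* e) t 2 2 =
  a/b≤c/d (2 ℕ.* suc e) t (2 ℕ.* e ℕ.* 3 ℕ.+ 2 ℕ.* s) (2 ℕ.+ t ℕ.* 3) (begin
    2 ℕ.* suc e ℕ.* (3 ℕ.+ t ℕ.* 3)     ≡⟨ solve (e ∷ t ∷ []) ⟩
    6 ℕ.* e ℕ.* s ℕ.+ s ℕ.* (2 ℕ.* 3)   ≤⟨ ℕ.+-monoʳ-≤ (6 ℕ.* e ℕ.* s) (ℕ.*-monoʳ-≤ s (ℕ.*-monoʳ-≤ 2 3≤s)) ⟩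
    6 ℕ.* e ℕ.* s ℕ.+ s ℕ.* (2 ℕ.* s)   ≡⟨ solve (e ∷ t ∷ []) ⟩
    (2 ℕ.* e ℕ.* 3 ℕ.+ 2 ℕ.* s) ℕ.* s  ∎)
  where open ℕ.≤-Reasoning

∈-allSubsets : ∀ {n} (S : Subset n) → S ∈ allSubsets n
∈-allSubsets []ᵛ            = here refl
∈-allSubsets (inside ∷ᵛ S)  = ∈-++⁺ˡ (∈-map⁺ (inside ∷ᵛ_) (∈-allSubsets S))
∈-allSubsets (outside ∷ᵛ S) = ∈-++⁺ʳ _ (∈-map⁺ (outside ∷ᵛ_) (∈-allSubsets S))

∣p∪q∣≤∣p∣+∣q∣ : ∀ {n} (p q : Subset n) → ∣ p ∪ q ∣ ℕ.≤ ∣ p ∣ ℕ.+ ∣ q ∣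
∣p∪q∣≤∣p∣+∣q∣ []ᵛ            []ᵛ            = z≤n
∣p∪q∣≤∣p∣+∣q∣ (inside ∷ᵛ p)  (inside ∷ᵛ q)  =
  s≤s (ℕ.≤-trans (∣p∪q∣≤∣p∣+∣q∣ p q) (ℕ.+-monoʳ-≤ ∣ p ∣ (ℕ.n≤1+n ∣ q ∣)))
∣p∪q∣≤∣p∣+∣q∣ (inside ∷ᵛ p)  (outside ∷ᵛ q) = s≤s (∣p∪q∣≤∣p∣+∣q∣ p q)
∣p∪q∣≤∣p∣+∣q∣ (outside ∷ᵛ p) (inside ∷ᵛ q)  =
  ℕ.≤-trans (s≤s (∣p∪q∣≤∣p∣+∣q∣ p q)) (ℕ.≤-reflexive (sym (ℕ.+-suc ∣ p ∣ ∣ q ∣)))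
∣p∪q∣≤∣p∣+∣q∣ (outside ∷ᵛ p) (outside ∷ᵛ q) = ∣p∪q∣≤∣p∣+∣q∣ p q

edgesIn : ∀ {n} → Subset n → Graph n → ℕ
edgesIn S G = length (filterᵇ (insideᵇ S) G)

densityOn : ∀ {n} → Graph n → Subset n → ℚ
densityOn G S = density (edgesIn S G) ∣ S ∣

subsetDensities : ∀ {n} → Graph n → Subset n → List ℚ
subsetDensities G S = map (λ F → density (length F) ∣ S ∣) (sublists (filterᵇ (insideᵇ S) G))

nonemptySubsets : ∀ n → List (Subset n)
nonemptySubsets n = filterᵇ (λ S → nonemptyᵇ ∣ S ∣) (allSubsets n)

T-nonemptyᵇ : ∀ {m} → T (nonemptyᵇ m) ⇔ 0 ℕ.< m
T-nonemptyᵇ {zero}  = mk⇔ (λ ()) (λ ())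
T-nonemptyᵇ {suc m} = mk⇔ (λ _ → s≤s z≤n) (λ _ → tt)

densityOn≤Mad : ∀ {n} (G : Graph n) {S} → 0 ℕ.< ∣ S ∣ → densityOn G S ≤ Mad G
densityOn≤Mad {n} G {S} 0<∣S∣ = ≤-maxℚ (∈-concatMap⁺ (subsetDensities G) {xs = nonemptySubsets n}
  (lose {P = λ S′ → densityOn G S ∈ subsetDensities G S′} S∈
    (∈-map⁺ (λ F → density (length F) ∣ S ∣) (∈-sublists-self (filterᵇ (insideᵇ S) G)))))
  where
  S∈ : S ∈ nonemptySubsets n
  S∈ = ∈-filter⁺ (T? ∘ (λ S → nonemptyᵇ ∣ S ∣)) (∈-allSubsets S) (Equivalence.from T-nonemptyᵇ 0<∣S∣)

Mad-attained : ∀ {n} (G : Graph n) → Mad G ≡ 0ℚ ⊎ ∃[ S ] (0 ℕ.< ∣ S ∣ × Mad G ≤ densityOn G S)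
Mad-attained {n} G with maxℚ-sel (subgraphDensities G)
... | inj₁ Mad≡0 = inj₁ Mad≡0
... | inj₂ Mad∈ with find (∈-concatMap⁻ (subsetDensities G) {xs = nonemptySubsets n} Mad∈)
...   | S , S∈ , Mad∈S with ∈-filter⁻ (T? ∘ (λ S → nonemptyᵇ ∣ S ∣)) {xs = allSubsets n} S∈
                           | ∈-map⁻ (λ F → density (length F) ∣ S ∣) Mad∈S
...     | _ , S-nonempty | F , F∈ , Mad≡ = inj₂ (S , Equivalence.to T-nonemptyᵇ S-nonempty ,
          ≤-trans (≤-reflexive Mad≡) (density-mono ∣ S ∣ (length-∈-sublists (filterᵇ (insideᵇ S) G) F∈)))

0≤Mad : ∀ {n} (G : Graph n) → 0ℚ ≤ Mad G
0≤Mad G = 0≤maxℚ (subgraphDensities G)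

1≤Mad : ∀ {n} {G : Graph n} {e} → e ∈ G → 1ℚ ≤ Mad G
1≤Mad {G = G} {a , b} e∈G = ≤-trans (1≤density {edgesIn S G} 0<∣S∣ ∣S∣≤2e) (densityOn≤Mad G {S} 0<∣S∣)
  where
  S = ⁅ a ⁆ ∪ ⁅ b ⁆
  0<∣S∣ : 0 ℕ.< ∣ S ∣
  0<∣S∣ = ℕ.≤-trans (ℕ.≤-reflexive (sym (∣⁅x⁆∣≡1 a))) (∣p∣≤∣p∪q∣ ⁅ a ⁆ ⁅ b ⁆)
  e-inside : T (insideᵇ S (a , b))
  e-inside rewrite []=⇒lookup (x∈p∪q⁺ {p = ⁅ a ⁆} {q = ⁅ b ⁆} (inj₁ (x∈⁅x⁆ a)))
                 | []=⇒lookup (x∈p∪q⁺ {p = ⁅ a ⁆} {q = ⁅ b ⁆} (inj₂ (x∈⁅x⁆ b))) = tt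
  ∣S∣≤2e : ∣ S ∣ ℕ.≤ 2 ℕ.* edgesIn S G
  ∣S∣≤2e = ℕ.≤-trans (∣p∪q∣≤∣p∣+∣q∣ ⁅ a ⁆ ⁅ b ⁆)
             (ℕ.≤-trans (ℕ.≤-reflexive (cong₂ ℕ._+_ (∣⁅x⁆∣≡1 a) (∣⁅x⁆∣≡1 b)))
               (ℕ.*-monoʳ-≤ 2 (filter-some (T? ∘ insideᵇ S) {xs = G} (lose {P = T ∘ insideᵇ S} e∈G e-inside))))

edgesIn-++ : ∀ {n} (S : Subset n) G H → edgesIn S (G ++ H) ≡ edgesIn S G ℕ.+ edgesIn S H
edgesIn-++ S G H = trans (cong length (filter-++ (T? ∘ insideᵇ S) G H)) (length-++ (filterᵇ (insideᵇ S) G))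

edgesIn-insert : ∀ {n} (S : Subset n) A e B → T (insideᵇ S e) →
                 edgesIn S (A ++ e ∷ B) ≡ suc (edgesIn S (A ++ B))
edgesIn-insert S A e B e-inside = begin
  edgesIn S (A ++ e ∷ B)             ≡⟨ edgesIn-++ S A (e ∷ B) ⟩
  edgesIn S A ℕ.+ edgesIn S (e ∷ B)  ≡⟨ cong (λ es → edgesIn S A ℕ.+ length es)
                                              (filter-accept (T? ∘ insideᵇ S) e-inside) ⟩
  edgesIn S A ℕ.+ suc (edgesIn S B)  ≡⟨ ℕ.+-suc (edgesIn S A) (edgesIn S B) ⟩
  suc (edgesIn S A ℕ.+ edgesIn S B)  ≡⟨ cong suc (edgesIn-++ S A B) ⟨
  suc (edgesIn S (A ++ B))           ∎
  where open ≡-Reasoning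

edge-inside? : ∀ {n} (S : Subset n) G → edgesIn S G ≡ 0 ⊎ ∃[ e ] (e ∈ G × T (insideᵇ S e))
edge-inside? S G with filterᵇ (insideᵇ S) G in eq
... | []    = inj₁ refl
... | e ∷ _ = inj₂ (e , ∈-filter⁻ (T? ∘ insideᵇ S) {xs = G} (subst (e ∈_) (sym eq) (here refl)))

edgesIn-mono : ∀ {n} (S : Subset n) {G H : Graph n} → G ⊆ H → edgesIn S G ℕ.≤ edgesIn S H
edgesIn-mono S G⊆H = length-mono-≤ (filter⁺ (T? ∘ insideᵇ S) (T? ∘ insideᵇ S) (λ { refl p → p }) G⊆H)

liftE : ∀ {n} → Edge n → Edge (suc n)
liftE = Product.map suc suc

star : ∀ n → Graph (suc n)
star n = map (λ j → (zero , suc j)) (allFin n)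

-- Defs.edgesK n is concatMap (edgesFrom n) (allFin n).
edgesFrom : ∀ n → Fin n → Graph n
edgesFrom n i = map (λ j → (i , j)) (filterᵇ (λ j → toℕ i ℕ.<ᵇ toℕ j) (allFin n))

edgesK-suc : ∀ n → edgesK (suc n) ≡ star n ++ map liftE (edgesK n)
edgesK-suc n = begin
  edgesK (suc n)
    ≡⟨ cong (concatMap (edgesFrom (suc n))) allFin-suc ⟩
  edgesFrom (suc n) zero ++ concatMap (edgesFrom (suc n)) (map suc (allFin n))
    ≡⟨ cong₂ _++_ from-zero (concatMap-map (edgesFrom (suc n)) suc (allFin n)) ⟩
  star n ++ concatMap (edgesFrom (suc n) ∘ suc) (allFin n)
    ≡⟨ cong (star n ++_) (concatMap-cong from-suc (allFin n)) ⟩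
  star n ++ concatMap (map liftE ∘ edgesFrom n) (allFin n)
    ≡⟨ cong (star n ++_) (map-concatMap liftE (edgesFrom n) (allFin n)) ⟨
  star n ++ map liftE (edgesK n)
    ∎
  where
  open ≡-Reasoning
  from-zero : edgesFrom (suc n) zero ≡ star n
  from-zero = begin
    edgesFrom (suc n) zero
      ≡⟨ cong (λ js → map (zero ,_) (filterᵇ (λ j → 0 ℕ.<ᵇ toℕ j) js)) allFin-suc ⟩
    map (zero ,_) (filterᵇ (λ j → 0 ℕ.<ᵇ toℕ j) (map suc (allFin n)))
      ≡⟨ cong (map (zero ,_)) (filterᵇ-map _ suc (allFin n)) ⟩
    map (zero ,_) (map suc (filterᵇ (λ _ → true) (allFin n)))
      ≡⟨ cong (map (zero ,_) ∘ map suc) (filter-all (T? ∘ (λ _ → true)) (All.universal _ (allFin n))) ⟩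
    map (zero ,_) (map suc (allFin n))
      ≡⟨ map-∘ (allFin n) ⟨
    star n
      ∎
  from-suc : ∀ i → edgesFrom (suc n) (suc i) ≡ map liftE (edgesFrom n i)
  from-suc i = begin
    edgesFrom (suc n) (suc i)
      ≡⟨ cong (λ js → map (suc i ,_) (filterᵇ (λ j → suc (toℕ i) ℕ.<ᵇ toℕ j) js)) allFin-suc ⟩
    map (suc i ,_) (filterᵇ (λ j → suc (toℕ i) ℕ.<ᵇ toℕ j) (map suc (allFin n)))
      ≡⟨ cong (map (suc i ,_)) (filterᵇ-map _ suc (allFin n)) ⟩
    map (suc i ,_) (map suc (filterᵇ (λ j → toℕ i ℕ.<ᵇ toℕ j) (allFin n)))
      ≡⟨ map-∘ _ ⟨
    map (λ j → (suc i , suc j)) (filterᵇ (λ j → toℕ i ℕ.<ᵇ toℕ j) (allFin n))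
      ≡⟨ map-∘ _ ⟩
    map liftE (edgesFrom n i)
      ∎

length-star : ∀ n → length (star n) ≡ n
length-star n = trans (length-map _ (allFin n)) (length-tabulate id)

length-edgesK : ∀ n → length (edgesK n) ≡ n C 2
length-edgesK zero    = refl
length-edgesK (suc n) = begin
  length (edgesK (suc n))                            ≡⟨ cong length (edgesK-suc n) ⟩
  length (star n ++ map liftE (edgesK n))            ≡⟨ length-++ (star n) ⟩
  length (star n) ℕ.+ length (map liftE (edgesK n))  ≡⟨ cong₂ ℕ._+_ (length-star n) (length-map liftE (edgesK n)) ⟩
  n ℕ.+ length (edgesK n)                            ≡⟨ cong (n ℕ.+_) (length-edgesK n) ⟩
  n ℕ.+ n C 2                                        ≡⟨ cong (ℕ._+ n C 2) (nC1≡n n) ⟨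
  n C 1 ℕ.+ n C 2                                    ≡⟨ nCk+nC[k+1]≡[n+1]C[k+1] n 1 ⟩
  suc n C 2                                          ∎
  where open ≡-Reasoning

edgesIn-lift : ∀ {n} b (S : Subset n) G → edgesIn (b ∷ᵛ S) (map liftE G) ≡ edgesIn S G
edgesIn-lift b S G =
  trans (cong length (filterᵇ-map (insideᵇ (b ∷ᵛ S)) liftE G)) (length-map liftE (filterᵇ (insideᵇ S) G))

length-filter-lookup : ∀ {n} (S : Subset n) → length (filterᵇ (lookup S) (allFin n)) ≡ ∣ S ∣
length-filter-lookup []ᵛ = refl
length-filter-lookup {suc n} (b ∷ᵛ S) =
  trans (cong (length ∘ filterᵇ (lookup (b ∷ᵛ S))) allFin-suc) (split b)
  where
  rest : ∀ b → length (filterᵇ (lookup (b ∷ᵛ S)) (map suc (allFin n))) ≡ ∣ S ∣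
  rest b = trans (cong length (filterᵇ-map (lookup (b ∷ᵛ S)) suc (allFin n)))
                 (trans (length-map suc (filterᵇ (lookup S) (allFin n))) (length-filter-lookup S))
  split : ∀ b → length (filterᵇ (lookup (b ∷ᵛ S)) (zero ∷ map suc (allFin n))) ≡ ∣ b ∷ᵛ S ∣
  split inside  = cong suc (rest inside)
  split outside = rest outside

edgesIn-star-outside : ∀ {n} (S : Subset n) → edgesIn (outside ∷ᵛ S) (star n) ≡ 0
edgesIn-star-outside {n} S = cong length
  (trans (filterᵇ-map (insideᵇ (outside ∷ᵛ S)) (λ j → (zero , suc j)) (allFin n))
         (cong (map _) (filter-none (T? ∘ (λ _ → false)) (All.universal (λ _ ()) (allFin n)))))

edgesIn-star-inside : ∀ {n} (S : Subset n) → edgesIn (inside ∷ᵛ S) (star n) ≡ ∣ S ∣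
edgesIn-star-inside {n} S = begin
  edgesIn (inside ∷ᵛ S) (star n)
    ≡⟨ cong length (filterᵇ-map (insideᵇ (inside ∷ᵛ S)) _ (allFin n)) ⟩
  length (map (λ j → (zero , suc j)) (filterᵇ (lookup S) (allFin n)))
    ≡⟨ length-map _ (filterᵇ (lookup S) (allFin n)) ⟩
  length (filterᵇ (lookup S) (allFin n))
    ≡⟨ length-filter-lookup S ⟩
  ∣ S ∣
    ∎
  where open ≡-Reasoning

edgesIn-cone : ∀ {n} b (S : Subset n) G →
               edgesIn (b ∷ᵛ S) (star n ++ map liftE G) ≡ edgesIn (b ∷ᵛ S) (star n) ℕ.+ edgesIn S G
edgesIn-cone b S G = trans (edgesIn-++ (b ∷ᵛ S) (star _) (map liftE G))
                           (cong (edgesIn (b ∷ᵛ S) (star _) ℕ.+_) (edgesIn-lift b S G))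

edgesK-FitsInK : ∀ n (S : Subset n) → FitsInK (edgesIn S (edgesK n)) ∣ S ∣
edgesK-FitsInK zero    []ᵛ      = z≤n
edgesK-FitsInK (suc n) (b ∷ᵛ S) rewrite edgesK-suc n | edgesIn-cone b S (edgesK n) = cone b
  where
  cone : ∀ b → FitsInK (edgesIn (b ∷ᵛ S) (star n) ℕ.+ edgesIn S (edgesK n)) ∣ b ∷ᵛ S ∣
  cone outside rewrite edgesIn-star-outside S = edgesK-FitsInK n S
  cone inside  rewrite edgesIn-star-inside S  = FitsInK-cone (edgesK-FitsInK n S)

⊆edgesK⇒FitsInK : ∀ {n} {G : Graph n} → G ⊆ edgesK n → ∀ S → FitsInK (edgesIn S G) ∣ S ∣
⊆edgesK⇒FitsInK {n} G⊆K S =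
  ℕ.≤-trans (ℕ.+-monoˡ-≤ ∣ S ∣ (ℕ.*-monoʳ-≤ 2 (edgesIn-mono S G⊆K))) (edgesK-FitsInK n S)

-- Mad under coning and under removing an edge

Mad-lift : ∀ {n} (G : Graph n) → Mad G ≤ Mad (map liftE G)
Mad-lift G with Mad-attained G
... | inj₁ Mad≡0 = subst (_≤ Mad (map liftE G)) (sym Mad≡0) (0≤Mad (map liftE G))
... | inj₂ (S , 0<∣S∣ , Mad≤) = begin
  Mad G                                   ≤⟨ Mad≤ ⟩
  densityOn G S                           ≡⟨ cong (λ e → density e ∣ S ∣) (edgesIn-lift outside S G) ⟨
  densityOn (map liftE G) (outside ∷ᵛ S)  ≤⟨ densityOn≤Mad (map liftE G) {outside ∷ᵛ S} 0<∣S∣ ⟩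
  Mad (map liftE G)                       ∎
  where open ≤-Reasoning

Mad-cone : ∀ {n} {G : Graph (suc n)} → G ⊆ edgesK (suc n) → Mad G + 1ℚ ≤ Mad (star (suc n) ++ map liftE G)
Mad-cone {n} {G} G⊆K with Mad-attained G
... | inj₁ Mad≡0 rewrite Mad≡0 =
  1≤Mad {G = star (suc n) ++ map liftE G} (∈-++⁺ˡ {ys = map liftE G} (here refl))
... | inj₂ (S , 0<∣S∣ , Mad≤) = begin
  Mad G + 1ℚ
    ≤⟨ +-monoˡ-≤ 1ℚ Mad≤ ⟩
  densityOn G S + 1ℚ
    ≤⟨ density-cone 0<∣S∣ (⊆edgesK⇒FitsInK G⊆K S) ⟩
  density (∣ S ∣ ℕ.+ edgesIn S G) (suc ∣ S ∣)
    ≡⟨ cong (λ e → density e (suc ∣ S ∣)) cone-edges ⟨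
  densityOn (star (suc n) ++ map liftE G) (inside ∷ᵛ S)
    ≤⟨ densityOn≤Mad (star (suc n) ++ map liftE G) {inside ∷ᵛ S} (s≤s z≤n) ⟩
  Mad (star (suc n) ++ map liftE G)
    ∎
  where
  open ≤-Reasoning
  cone-edges : edgesIn (inside ∷ᵛ S) (star (suc n) ++ map liftE G) ≡ ∣ S ∣ ℕ.+ edgesIn S G
  cone-edges = trans (edgesIn-cone inside S G) (cong (ℕ._+ edgesIn S G) (edgesIn-star-inside S))

CheapEdge : ∀ {n} → Graph n → Edge n → Set
CheapEdge G e = ∀ A B → G ≡ A ++ e ∷ B → ∀ {x} → x ∈ A ++ B → Mad G ≤ Mad (A ++ B) + + 2 / 3

cheap-if-Mad≤1 : ∀ {n} {G : Graph n} {e} → Mad G ≤ 1ℚ → CheapEdge G e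
cheap-if-Mad≤1 {G = G} Mad≤1 A B _ x∈ = begin
  Mad G                   ≤⟨ Mad≤1 ⟩
  1ℚ                      ≤⟨ 1≤Mad x∈ ⟩
  Mad (A ++ B)            ≡⟨ +-identityʳ (Mad (A ++ B)) ⟨
  Mad (A ++ B) + 0ℚ       ≤⟨ +-monoʳ-≤ (Mad (A ++ B)) (a/b≤c/d 0 0 2 2 z≤n) ⟩
  Mad (A ++ B) + + 2 / 3  ∎
  where open ≤-Reasoning

cheap-if-in-densest : ∀ {n} {G : Graph n} {S e} → 3 ℕ.≤ ∣ S ∣ → T (insideᵇ S e) →
                      Mad G ≤ densityOn G S → CheapEdge G e
cheap-if-in-densest {S = S} {e} 3≤∣S∣ e-inside Mad≤ A B refl _ = begin
  Mad (A ++ e ∷ B)                          ≤⟨ Mad≤ ⟩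
  density (edgesIn S (A ++ e ∷ B)) ∣ S ∣    ≡⟨ cong (λ m → density m ∣ S ∣) (edgesIn-insert S A e B e-inside) ⟩
  density (suc (edgesIn S (A ++ B))) ∣ S ∣  ≤⟨ density-suc≤ 3≤∣S∣ ⟩
  densityOn (A ++ B) S + + 2 / 3            ≤⟨ +-monoˡ-≤ (+ 2 / 3) (densityOn≤Mad (A ++ B) {S} 0<∣S∣) ⟩
  Mad (A ++ B) + + 2 / 3                    ∎
  where
  open ≤-Reasoning
  0<∣S∣ : 0 ℕ.< ∣ S ∣
  0<∣S∣ = ℕ.≤-trans (s≤s z≤n) 3≤∣S∣

∃-cheap-edge : ∀ {n} {G : Graph n} {x} → G ⊆ edgesK n → x ∈ G → ∃[ e ] (e ∈ G × CheapEdge G e)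
∃-cheap-edge {G = G} {x} G⊆K x∈G with Mad-attained G
... | inj₁ Mad≡0 = x , x∈G , cheap-if-Mad≤1 (≤-trans (≤-reflexive Mad≡0) (a/b≤c/d 0 0 1 0 z≤n))
... | inj₂ (S , _ , Mad≤) with ∣ S ∣ ℕ.≤? 2 | edge-inside? S G
...   | no ∣S∣≰2  | inj₂ (e , e∈G , e-inside) =
  e , e∈G , cheap-if-in-densest {S = S} (ℕ.≰⇒> ∣S∣≰2) e-inside Mad≤
...   | yes ∣S∣≤2 | _ =
  x , x∈G , cheap-if-Mad≤1
    (≤-trans Mad≤ (density≤1 (FitsInK-≤2 {edgesIn S G} (⊆edgesK⇒FitsInK G⊆K S) ∣S∣≤2)))
...   | no _      | inj₁ none =
  x , x∈G , cheap-if-Mad≤1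
    (≤-trans Mad≤ (density≤1 {edgesIn S G} (subst (λ m → 2 ℕ.* m ℕ.≤ ∣ S ∣) (sym none) z≤n)))

∑ : ∀ {k} → (Fin k → ℚ) → ℚ
∑ {k} f = sumℚ (map f (allFin k))

∑-suc : ∀ {k} (f : Fin (suc k) → ℚ) → ∑ f ≡ f zero + ∑ (f ∘ suc)
∑-suc {k} f = cong sumℚ (trans (cong (map f) allFin-suc) (cong (f zero ∷_) (sym (map-∘ (allFin k)))))

∑-cong : ∀ {k} {f g : Fin k → ℚ} → (∀ c → f c ≡ g c) → ∑ f ≡ ∑ g
∑-cong {k} f≗g = cong sumℚ (map-cong f≗g (allFin k))

0≤∑ : ∀ {k} {f : Fin k → ℚ} → (∀ c → 0ℚ ≤ f c) → 0ℚ ≤ ∑ f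
0≤∑ {zero}      _   = ≤-refl
0≤∑ {suc k} {f} 0≤f = subst (0ℚ ≤_) (sym (∑-suc f)) (+-mono-≤ (0≤f zero) (0≤∑ (0≤f ∘ suc)))

∑-mono : ∀ {k} {f g : Fin k → ℚ} → (∀ c → f c ≤ g c) → ∑ f ≤ ∑ g
∑-mono {zero}          _   = ≤-refl
∑-mono {suc k} {f} {g} f≤g =
  subst₂ _≤_ (sym (∑-suc f)) (sym (∑-suc g)) (+-mono-≤ (f≤g zero) (∑-mono (f≤g ∘ suc)))

∑-mono-at : ∀ {k} {f g : Fin k → ℚ} {a b} c₀ → (∀ c → c ≢ c₀ → f c ≤ g c) → f c₀ + a ≤ g c₀ + b →
            ∑ f + a ≤ ∑ g + b
∑-mono-at {suc k} {f} {g} {a} {b} zero f≤g fa≤gb = begin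
  ∑ f + a                   ≡⟨ cong (_+ a) (∑-suc f) ⟩
  f zero + ∑ (f ∘ suc) + a  ≡⟨ xy∙z≈xz∙y (f zero) (∑ (f ∘ suc)) a ⟩
  f zero + a + ∑ (f ∘ suc)  ≤⟨ +-mono-≤ fa≤gb (∑-mono (λ c → f≤g (suc c) λ ())) ⟩
  g zero + b + ∑ (g ∘ suc)  ≡⟨ xy∙z≈xz∙y (g zero) b (∑ (g ∘ suc)) ⟩
  g zero + ∑ (g ∘ suc) + b  ≡⟨ cong (_+ b) (∑-suc g) ⟨
  ∑ g + b                   ∎
  where
  open ≤-Reasoning
  open import Algebra.Properties.CommutativeSemigroup
    (CommutativeMonoid.commutativeSemigroup +-0-commutativeMonoid) using (xy∙z≈xz∙y)
∑-mono-at {suc k} {f} {g} {a} {b} (suc c₀) f≤g fa≤gb = begin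
  ∑ f + a                     ≡⟨ cong (_+ a) (∑-suc f) ⟩
  f zero + ∑ (f ∘ suc) + a    ≡⟨ +-assoc (f zero) (∑ (f ∘ suc)) a ⟩
  f zero + (∑ (f ∘ suc) + a)  ≤⟨ +-mono-≤ (f≤g zero λ ()) (∑-mono-at c₀ f≤g-suc fa≤gb) ⟩
  g zero + (∑ (g ∘ suc) + b)  ≡⟨ +-assoc (g zero) (∑ (g ∘ suc)) b ⟨
  g zero + ∑ (g ∘ suc) + b    ≡⟨ cong (_+ b) (∑-suc g) ⟨
  ∑ g + b                     ∎
  where
  open ≤-Reasoning
  f≤g-suc : ∀ c → c ≢ c₀ → f (suc c) ≤ g (suc c)
  f≤g-suc c c≢c₀ = f≤g (suc c) (c≢c₀ ∘ suc-injective)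

-- A colouring as the list of its coloured edges: Defs.colourClass col c is, by definition,
-- class c (zip (edgesK n) (colours col)).
ColouredEdges : ℕ → ℕ → Set
ColouredEdges k n = List (Edge n × Fin k)

class : ∀ {k n} → Fin k → ColouredEdges k n → Graph n
class c L = map proj₁ (filterᵇ (λ p → ⌊ proj₂ p ≟ c ⌋) L)

value : ∀ {k n} → ColouredEdges k n → ℚ
value L = ∑ (λ c → Mad (class c L))

0≤value : ∀ {k n} (L : ColouredEdges k n) → 0ℚ ≤ value L
0≤value L = 0≤∑ (λ c → 0≤Mad (class c L))

record IsPartition {k n} (L : ColouredEdges k n) : Set where
  field
    edges    : map proj₁ L ≡ edgesK n
    nonempty : ∀ c → ∃[ e ] e ∈ class c L
open IsPartition

length-partition : ∀ {k n} {L : ColouredEdges k n} → IsPartition L → length L ≡ n C 2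
length-partition {n = n} {L} L-part =
  trans (sym (length-map proj₁ L)) (trans (cong length (edges L-part)) (length-edgesK n))

class-++ : ∀ {k n} (c : Fin k) (L L′ : ColouredEdges k n) → class c (L ++ L′) ≡ class c L ++ class c L′
class-++ c L L′ = trans (cong (map proj₁) (filter-++ (λ p → T? ⌊ proj₂ p ≟ c ⌋) L L′))
                        (map-++ proj₁ (filterᵇ (λ p → ⌊ proj₂ p ≟ c ⌋) L) (filterᵇ (λ p → ⌊ proj₂ p ≟ c ⌋) L′))

∈-class⁺ : ∀ {k n} {c : Fin k} {e} {L : ColouredEdges k n} → (e , c) ∈ L → e ∈ class c L
∈-class⁺ {c = c} ec∈L = ∈-map⁺ proj₁ (∈-filter⁺ (λ p → T? ⌊ proj₂ p ≟ c ⌋) ec∈L (fromWitness refl))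

∈-class⁻ : ∀ {k n} {c : Fin k} {e} {L : ColouredEdges k n} → e ∈ class c L → (e , c) ∈ L
∈-class⁻ {c = c} {L = L} e∈ with ∈-map⁻ proj₁ e∈
... | (e , d) , ed∈ , refl with ∈-filter⁻ (λ p → T? ⌊ proj₂ p ≟ c ⌋) {xs = L} ed∈
...   | ed∈L , d≟c = subst (λ d → (e , d) ∈ L) (toWitness d≟c) ed∈L

class-⊆ : ∀ {k n} (c : Fin k) (L : ColouredEdges k n) → class c L ⊆ map proj₁ L
class-⊆ c L = ⊆-map⁺ proj₁ (filter-⊆ (λ p → T? ⌊ proj₂ p ≟ c ⌋) L)

class-⊆edgesK : ∀ {k n} {L : ColouredEdges k n} → IsPartition L → ∀ c → class c L ⊆ edgesK n
class-⊆edgesK {L = L} L-part c = subst (class c L ⊆_) (edges L-part) (class-⊆ c L)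

length-class-∷ : ∀ {k n} (c : Fin k) p (L : ColouredEdges k n) →
                 length (class c L) ℕ.≤ length (class c (p ∷ L))
length-class-∷ c p L rewrite class-++ c [ p ] L | length-++ (class c [ p ]) {class c L} = ℕ.m≤n+m _ _

∈-colours⇒class : ∀ {k n} {c : Fin k} {L : ColouredEdges k n} → c ∈ map proj₂ L → ∃[ e ] e ∈ class c L
∈-colours⇒class c∈ with ∈-map⁻ proj₂ c∈
... | (e , _) , ec∈ , refl = e , ∈-class⁺ ec∈

∈-allWords : ∀ k (ws : List (Fin k)) → ws ∈ allWords k (length ws)
∈-allWords k []       = here refl
∈-allWords k (w ∷ ws) = ∈-concatMap⁺ (λ c → map (c ∷_) (allWords k (length ws))) {xs = allFin k}
  (lose {P = λ c → w ∷ ws ∈ map (c ∷_) (allWords k (length ws))} (∈-allFin w)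
        (∈-map⁺ (w ∷_) (∈-allWords k ws)))

length-∈-allWords : ∀ k m {ws : List (Fin k)} → ws ∈ allWords k m → length ws ≡ m
length-∈-allWords k zero    (here refl) = refl
length-∈-allWords k (suc m) ws∈
  with find (∈-concatMap⁻ (λ c → map (c ∷_) (allWords k m)) {xs = allFin k} ws∈)
... | c , _ , ws∈c with ∈-map⁻ (c ∷_) ws∈c
...   | ws , ws∈ , refl = cong suc (length-∈-allWords k m ws∈)

T-surjectiveᵇ : ∀ {k n} (col : Colouring k n) → T (surjectiveᵇ col) ⇔ (∀ c → c ∈ colours col)
T-surjectiveᵇ {k} (colouring cs) = mk⇔
  (λ onto c → Any.map (sym ∘ toWitness)
    (any⁻ (λ d → ⌊ d ≟ c ⌋) cs (All.lookup (all⁺ appears (allFin k) onto) (∈-allFin c))))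
  (λ c∈ → all⁻ appears {xs = allFin k}
    (All.tabulate (λ {c} _ → any⁺ (λ d → ⌊ d ≟ c ⌋) (Any.map (fromWitness ∘ sym) (c∈ c)))))
  where
  appears : Fin k → Bool
  appears c = any (λ d → ⌊ d ≟ c ⌋) cs

∈-partitions⁺ : ∀ {k n} (cs : List (Fin k)) → length cs ≡ length (edgesK n) → (∀ c → c ∈ cs) →
                colouring cs ∈ partitions k n
∈-partitions⁺ {k} {n} cs cs-length cs-onto = ∈-filter⁺ (T? ∘ surjectiveᵇ)
  (∈-map⁺ colouring (subst (λ m → cs ∈ allWords k m) cs-length (∈-allWords k cs)))
  (Equivalence.from (T-surjectiveᵇ (colouring {n = n} cs)) cs-onto)

∈-partitions⁻ : ∀ {k n} {col : Colouring k n} → col ∈ partitions k n →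
                length (colours col) ≡ length (edgesK n) × (∀ c → c ∈ colours col)
∈-partitions⁻ {k} {n} col∈
  with ∈-filter⁻ (T? ∘ surjectiveᵇ) {xs = map colouring (allWords k (length (edgesK n)))} col∈
... | col∈′ , onto with ∈-map⁻ colouring col∈′
...   | cs , cs∈ , refl = length-∈-allWords k _ cs∈ , Equivalence.to (T-surjectiveᵇ (colouring {n = n} cs)) onto

partition-exists : ∀ {k n} → suc k ℕ.≤ n C 2 → ∃[ col ] col ∈ partitions (suc k) n
partition-exists {k} {n} k<nC2 = colouring cs , ∈-partitions⁺ cs cs-length (λ c → ∈-++⁺ˡ (∈-allFin c))
  where
  m = length (edgesK n)
  cs = allFin (suc k) ++ replicate (m ℕ.∸ suc k) zero
  cs-length : length cs ≡ m
  cs-length = trans (length-++ (allFin (suc k)))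
    (trans (cong₂ ℕ._+_ (length-tabulate id) (length-replicate (m ℕ.∸ suc k)))
           (ℕ.m+[n∸m]≡n (subst (suc k ℕ.≤_) (sym (length-edgesK n)) k<nC2)))

partition⁻ : ∀ {k n} {col : Colouring k n} → col ∈ partitions k n → IsPartition (zip (edgesK n) (colours col))
partition⁻ {n = n} {colouring cs} col∈ with ∈-partitions⁻ col∈
... | cs-length , cs-onto = record
  { edges    = map-proj₁-zip (edgesK n) cs (sym cs-length)
  ; nonempty = λ c → ∈-colours⇒class (subst (c ∈_) (sym (map-proj₂-zip (edgesK n) cs (sym cs-length))) (cs-onto c))
  }

partition⁺ : ∀ {k n} {L : ColouredEdges k n} → IsPartition L → colouring (map proj₂ L) ∈ partitions k n
partition⁺ {L = L} L-part = ∈-partitions⁺ (map proj₂ L)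
  (trans (length-map proj₂ L) (trans (sym (length-map proj₁ L)) (cong length (edges L-part))))
  (λ c → ∈-map⁺ proj₂ (∈-class⁻ (proj₂ (nonempty L-part c))))

zip-edgesK : ∀ {k n} {L : ColouredEdges k n} → IsPartition L → zip (edgesK n) (map proj₂ L) ≡ L
zip-edgesK {L = L} L-part = trans (cong (λ E → zip E (map proj₂ L)) (sym (edges L-part))) (zip-map-proj L)

M-improve : ∀ {k n k′ n′} q → (∃[ col ] col ∈ partitions k n) →
            (∀ {L : ColouredEdges k n} → IsPartition L →
               ∃[ L′ ] (IsPartition {k′} {n′} L′ × value L + q ≤ value L′)) →
            M k n + q ≤ M k′ n′
M-improve {k} {n} {k′} {n′} q (col₀ , col₀∈) improve = bound (maxℚ-sel (map objective (partitions k n)))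
  where
  objective : ∀ {k n} → Colouring k n → ℚ
  objective {n = n} col = value (zip (edgesK n) (colours col))
  reach : ∀ {col} → col ∈ partitions k n → objective col + q ≤ M k′ n′
  reach col∈ with improve (partition⁻ col∈)
  ... | L′ , L′-part , ≤L′ = ≤-trans ≤L′ (subst (λ L → value L ≤ M k′ n′) (zip-edgesK L′-part)
                                          (≤-maxℚ (∈-map⁺ objective (partition⁺ L′-part))))
  bound : M k n ≡ 0ℚ ⊎ M k n ∈ map objective (partitions k n) → M k n + q ≤ M k′ n′
  bound (inj₁ M≡0) = begin
    M k n + q           ≡⟨ cong (_+ q) M≡0 ⟩
    0ℚ + q              ≤⟨ +-monoˡ-≤ q (0≤value (zip (edgesK n) (colours col₀))) ⟩
    objective col₀ + q  ≤⟨ reach col₀∈ ⟩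
    M k′ n′             ∎
    where open ≤-Reasoning
  bound (inj₂ M∈) with ∈-map⁻ objective M∈
  ... | col , col∈ , M≡ = subst (λ m → m + q ≤ M k′ n′) (sym M≡) (reach col∈)

-- Adding a vertex

class-map₁ : ∀ {k n m} (c : Fin k) (f : Edge n → Edge m) (L : ColouredEdges k n) →
             class c (map (Product.map₁ f) L) ≡ map f (class c L)
class-map₁ c f L = trans (cong (map proj₁) (filterᵇ-map (λ p → ⌊ proj₂ p ≟ c ⌋) (Product.map₁ f) L))
                         (map-proj₁-map₁ f (filterᵇ (λ p → ⌊ proj₂ p ≟ c ⌋) L))

class-zero-monochrome : ∀ {k n} (E : Graph n) → class {suc k} zero (map (_, zero) E) ≡ E
class-zero-monochrome E = trans
  (cong (map proj₁) (trans (filterᵇ-map _ (_, zero) E)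
                           (cong (map (_, zero)) (filter-all (T? ∘ (λ _ → true)) (All.universal _ E)))))
  (map-proj₁-map-pair zero E)

class-suc-monochrome : ∀ {k n} (c : Fin k) (E : Graph n) → class (suc c) (map (_, zero) E) ≡ []
class-suc-monochrome c E = cong (map proj₁) (trans (filterᵇ-map _ (_, zero) E)
  (cong (map (_, zero)) (filter-none (T? ∘ (λ _ → false)) (All.universal (λ _ ()) E))))

coneExtension : ∀ {k n} → ColouredEdges (suc k) (suc n) → ColouredEdges (suc k) (suc (suc n))
coneExtension {n = n} L = map (_, zero) (star (suc n)) ++ map (Product.map₁ liftE) L

class-coneExtension : ∀ {k n} c (L : ColouredEdges (suc k) (suc n)) →
  class c (coneExtension L) ≡ class c (map (_, zero) (star (suc n))) ++ map liftE (class c L)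
class-coneExtension {n = n} c L = trans (class-++ c (map (_, zero) (star (suc n))) (map (Product.map₁ liftE) L))
                                        (cong (class c (map (_, zero) (star (suc n))) ++_) (class-map₁ c liftE L))

class-coneExtension-zero : ∀ {k n} (L : ColouredEdges (suc k) (suc n)) →
                           class zero (coneExtension L) ≡ star (suc n) ++ map liftE (class zero L)
class-coneExtension-zero {n = n} L = trans (class-coneExtension zero L)
  (cong (_++ map liftE (class zero L)) (class-zero-monochrome (star (suc n))))

class-coneExtension-suc : ∀ {k n} c (L : ColouredEdges (suc k) (suc n)) →
                          class (suc c) (coneExtension L) ≡ map liftE (class (suc c) L)
class-coneExtension-suc {n = n} c L = trans (class-coneExtension (suc c) L)
  (cong (_++ map liftE (class (suc c) L)) (class-suc-monochrome c (star (suc n))))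

coneExtension-isPartition : ∀ {k n} {L : ColouredEdges (suc k) (suc n)} → IsPartition L →
                            IsPartition (coneExtension L)
coneExtension-isPartition {n = n} {L} L-part = record
  { edges    = begin
      map proj₁ (coneExtension L)
        ≡⟨ map-++ proj₁ (map (_, zero) (star (suc n))) (map (Product.map₁ liftE) L) ⟩
      map proj₁ (map (_, zero) (star (suc n))) ++ map proj₁ (map (Product.map₁ liftE) L)
        ≡⟨ cong₂ _++_ (map-proj₁-map-pair zero (star (suc n))) (map-proj₁-map₁ liftE L) ⟩
      star (suc n) ++ map liftE (map proj₁ L)
        ≡⟨ cong (λ E → star (suc n) ++ map liftE E) (edges L-part) ⟩
      star (suc n) ++ map liftE (edgesK (suc n))
        ≡⟨ edgesK-suc (suc n) ⟨
      edgesK (suc (suc n))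
        ∎
  ; nonempty = λ c → let e , e∈ = nonempty L-part c in
      liftE e , subst (liftE e ∈_) (sym (class-coneExtension c L)) (∈-++⁺ʳ _ (∈-map⁺ liftE e∈))
  }
  where open ≡-Reasoning

coneExtension-value : ∀ {k n} {L : ColouredEdges (suc k) (suc n)} → IsPartition L →
                      value L + 1ℚ ≤ value (coneExtension L)
coneExtension-value {L = L} L-part =
  subst (value L + 1ℚ ≤_) (+-identityʳ (value (coneExtension L))) (∑-mono-at zero others at-zero)
  where
  others : ∀ c → c ≢ zero → Mad (class c L) ≤ Mad (class c (coneExtension L))
  others zero    z≢z = ⊥-elim (z≢z refl)
  others (suc c) _   =
    subst (λ G → Mad (class (suc c) L) ≤ Mad G) (sym (class-coneExtension-suc c L)) (Mad-lift (class (suc c) L))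
  at-zero : Mad (class zero L) + 1ℚ ≤ Mad (class zero (coneExtension L)) + 0ℚ
  at-zero = subst (Mad (class zero L) + 1ℚ ≤_)
    (trans (cong Mad (sym (class-coneExtension-zero L))) (sym (+-identityʳ _)))
    (Mad-cone (class-⊆edgesK L-part zero))

coneExtension-step : ∀ {k n} {L : ColouredEdges (suc k) (suc n)} → IsPartition L →
                     ∃[ L′ ] (IsPartition L′ × value L + 1ℚ ≤ value L′)
coneExtension-step L-part = coneExtension _ , coneExtension-isPartition L-part , coneExtension-value L-part

-- Adding a colour

class-insert-same : ∀ {k n} (L₁ : ColouredEdges k n) e c₀ L₂ →
                    class c₀ (L₁ ++ (e , c₀) ∷ L₂) ≡ class c₀ L₁ ++ e ∷ class c₀ L₂
class-insert-same L₁ e c₀ L₂ = trans (class-++ c₀ L₁ ((e , c₀) ∷ L₂))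
  (cong (λ es → class c₀ L₁ ++ map proj₁ es)
        (filter-accept (λ p → T? ⌊ proj₂ p ≟ c₀ ⌋) {x = e , c₀} {xs = L₂} (fromWitness refl)))

class-insert-other : ∀ {k n} (L₁ : ColouredEdges k n) e {c₀ c} L₂ → c₀ ≢ c →
                     class c (L₁ ++ (e , c₀) ∷ L₂) ≡ class c (L₁ ++ L₂)
class-insert-other L₁ e {c₀} {c} L₂ c₀≢c = begin
  class c (L₁ ++ (e , c₀) ∷ L₂)
    ≡⟨ class-++ c L₁ ((e , c₀) ∷ L₂) ⟩
  class c L₁ ++ class c ((e , c₀) ∷ L₂)
    ≡⟨ cong (λ es → class c L₁ ++ map proj₁ es)
            (filter-reject (λ p → T? ⌊ proj₂ p ≟ c ⌋) {x = e , c₀} {xs = L₂} (c₀≢c ∘ toWitness)) ⟩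
  class c L₁ ++ class c L₂
    ≡⟨ class-++ c L₁ L₂ ⟨
  class c (L₁ ++ L₂)
    ∎
  where open ≡-Reasoning

two-in-class : ∀ {k n} (L : ColouredEdges k n) (i j : Fin (length L)) → toℕ i ℕ.< toℕ j →
               proj₂ (List.lookup L i) ≡ proj₂ (List.lookup L j) →
               2 ℕ.≤ length (class (proj₂ (List.lookup L i)) L)
two-in-class ((e , c) ∷ L) zero (suc j) _ c≡ = subst (λ G → 2 ℕ.≤ length G) (sym (class-insert-same [] e c L))
  (s≤s (∈-length (∈-class⁺ (subst (λ d → (proj₁ (List.lookup L j) , d) ∈ L) (sym c≡) (∈-lookup j)))))
two-in-class (p ∷ L) (suc i) (suc j) (s≤s i<j) c≡ =
  ℕ.≤-trans (two-in-class L i j i<j c≡) (length-class-∷ _ p L)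

∃-large-class : ∀ {k n} (L : ColouredEdges k n) → k ℕ.< length L → ∃[ c ] 2 ℕ.≤ length (class c L)
∃-large-class L k<|L| with pigeonhole k<|L| (proj₂ ∘ List.lookup L)
... | i , j , i<j , same = proj₂ (List.lookup L i) , two-in-class L i j i<j same

class-remainder : ∀ {k n} (L₁ : ColouredEdges k n) e c₀ L₂ → 2 ℕ.≤ length (class c₀ (L₁ ++ (e , c₀) ∷ L₂)) →
                  ∃[ x ] x ∈ class c₀ (L₁ ++ L₂)
class-remainder L₁ e c₀ L₂ 2≤ =
  nonempty⇒∈ (class c₀ (L₁ ++ L₂)) (ℕ.s≤s⁻¹ (subst (2 ℕ.≤_) length-insert 2≤))
  where
  open ≡-Reasoning
  length-insert : length (class c₀ (L₁ ++ (e , c₀) ∷ L₂)) ≡ suc (length (class c₀ (L₁ ++ L₂)))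
  length-insert = begin
    length (class c₀ (L₁ ++ (e , c₀) ∷ L₂))    ≡⟨ cong length (class-insert-same L₁ e c₀ L₂) ⟩
    length (class c₀ L₁ ++ e ∷ class c₀ L₂)    ≡⟨ length-++-sucʳ (class c₀ L₁) e (class c₀ L₂) ⟩
    suc (length (class c₀ L₁ ++ class c₀ L₂))  ≡⟨ cong (suc ∘ length) (class-++ c₀ L₁ L₂) ⟨
    suc (length (class c₀ (L₁ ++ L₂)))         ∎

-- The colouring L₁ ++ (e , c₀) ∷ L₂ with e moved to the new colour zero.
isolateEdge : ∀ {k n} → ColouredEdges k n → Edge n → ColouredEdges k n → ColouredEdges (suc k) n
isolateEdge L₁ e L₂ = map (Product.map₂ suc) L₁ ++ (e , zero) ∷ map (Product.map₂ suc) L₂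

class-map₂-zero : ∀ {k n} (L : ColouredEdges k n) → class zero (map (Product.map₂ suc) L) ≡ []
class-map₂-zero L = cong (map proj₁) (trans (filterᵇ-map _ (Product.map₂ suc) L)
  (cong (map (Product.map₂ suc)) (filter-none (T? ∘ (λ _ → false)) (All.universal (λ _ ()) L))))

class-map₂-suc : ∀ {k n} (c : Fin k) (L : ColouredEdges k n) → class (suc c) (map (Product.map₂ suc) L) ≡ class c L
class-map₂-suc c []      = refl
class-map₂-suc c (p ∷ L) with proj₂ p ≟ c
... | yes _ = cong (proj₁ p ∷_) (class-map₂-suc c L)
... | no _  = class-map₂-suc c L

class-isolateEdge-zero : ∀ {k n} (L₁ : ColouredEdges k n) e L₂ → class zero (isolateEdge L₁ e L₂) ≡ [ e ]
class-isolateEdge-zero L₁ e L₂ =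
  trans (class-++ zero (map (Product.map₂ suc) L₁) ((e , zero) ∷ map (Product.map₂ suc) L₂))
        (cong₂ (λ A B → A ++ e ∷ B) (class-map₂-zero L₁) (class-map₂-zero L₂))

class-isolateEdge-suc : ∀ {k n} c (L₁ : ColouredEdges k n) e L₂ →
                        class (suc c) (isolateEdge L₁ e L₂) ≡ class c (L₁ ++ L₂)
class-isolateEdge-suc c L₁ e L₂ =
  trans (class-++ (suc c) (map (Product.map₂ suc) L₁) ((e , zero) ∷ map (Product.map₂ suc) L₂))
        (trans (cong₂ _++_ (class-map₂-suc c L₁) (class-map₂-suc c L₂)) (sym (class-++ c L₁ L₂)))

isolateEdge-isPartition : ∀ {k n} {L₁ : ColouredEdges k n} {e c₀ L₂} → IsPartition (L₁ ++ (e , c₀) ∷ L₂) →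
                          ∃[ x ] x ∈ class c₀ (L₁ ++ L₂) → IsPartition (isolateEdge L₁ e L₂)
isolateEdge-isPartition {L₁ = L₁} {e} {c₀} {L₂} L-part (x , x∈) = record
  { edges    = begin
      map proj₁ (isolateEdge L₁ e L₂)
        ≡⟨ map-++ proj₁ (map (Product.map₂ suc) L₁) ((e , zero) ∷ map (Product.map₂ suc) L₂) ⟩
      map proj₁ (map (Product.map₂ suc) L₁) ++ e ∷ map proj₁ (map (Product.map₂ suc) L₂)
        ≡⟨ cong₂ (λ E₁ E₂ → E₁ ++ e ∷ E₂) (map-proj₁-map₂ suc L₁) (map-proj₁-map₂ suc L₂) ⟩
      map proj₁ L₁ ++ e ∷ map proj₁ L₂
        ≡⟨ map-++ proj₁ L₁ ((e , c₀) ∷ L₂) ⟨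
      map proj₁ (L₁ ++ (e , c₀) ∷ L₂)
        ≡⟨ edges L-part ⟩
      edgesK _
        ∎
  ; nonempty = nonempty′
  }
  where
  open ≡-Reasoning
  nonempty′ : ∀ c → ∃[ e′ ] e′ ∈ class c (isolateEdge L₁ e L₂)
  nonempty′ zero = e , subst (e ∈_) (sym (class-isolateEdge-zero L₁ e L₂)) (here refl)
  nonempty′ (suc c) with c ≟ c₀
  ... | yes refl = x , subst (x ∈_) (sym (class-isolateEdge-suc c L₁ e L₂)) x∈
  ... | no c≢c₀  = let e′ , e′∈ = nonempty L-part c in
    e′ , subst (e′ ∈_) (trans (class-insert-other L₁ e L₂ (c≢c₀ ∘ sym)) (sym (class-isolateEdge-suc c L₁ e L₂)))
               e′∈

isolateEdge-value : ∀ {k n} {L₁ : ColouredEdges k n} {e c₀ L₂} → CheapEdge (class c₀ (L₁ ++ (e , c₀) ∷ L₂)) e →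
                    ∃[ x ] x ∈ class c₀ (L₁ ++ L₂) →
                    value (L₁ ++ (e , c₀) ∷ L₂) + + 1 / 3 ≤ value (isolateEdge L₁ e L₂)
isolateEdge-value {L₁ = L₁} {e} {c₀} {L₂} cheap (x , x∈) = begin
  value (L₁ ++ (e , c₀) ∷ L₂) + + 1 / 3
    ≤⟨ ∑-mono-at c₀ others at-c₀ ⟩
  ∑ remaining + 1ℚ
    ≤⟨ +-monoʳ-≤ (∑ remaining) (1≤Mad {G = [ e ]} (here refl)) ⟩
  ∑ remaining + Mad [ e ]
    ≡⟨ +-comm (∑ remaining) (Mad [ e ]) ⟩
  Mad [ e ] + ∑ remaining
    ≡⟨ cong₂ _+_ (cong Mad (class-isolateEdge-zero L₁ e L₂))
                 (∑-cong (λ c → cong Mad (class-isolateEdge-suc c L₁ e L₂))) ⟨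
  Mad (class zero (isolateEdge L₁ e L₂)) + ∑ (λ c → Mad (class (suc c) (isolateEdge L₁ e L₂)))
    ≡⟨ ∑-suc (λ c → Mad (class c (isolateEdge L₁ e L₂))) ⟨
  value (isolateEdge L₁ e L₂)
    ∎
  where
  open ≤-Reasoning
  remaining : Fin _ → ℚ
  remaining c = Mad (class c (L₁ ++ L₂))
  others : ∀ c → c ≢ c₀ → Mad (class c (L₁ ++ (e , c₀) ∷ L₂)) ≤ remaining c
  others c c≢c₀ = ≤-reflexive (cong Mad (class-insert-other L₁ e L₂ (c≢c₀ ∘ sym)))
  at-c₀ : Mad (class c₀ (L₁ ++ (e , c₀) ∷ L₂)) + + 1 / 3 ≤ remaining c₀ + 1ℚ
  at-c₀ = begin
    Mad (class c₀ (L₁ ++ (e , c₀) ∷ L₂)) + + 1 / 3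
      ≤⟨ +-monoˡ-≤ (+ 1 / 3) (cheap (class c₀ L₁) (class c₀ L₂) (class-insert-same L₁ e c₀ L₂)
                                    (subst (x ∈_) (class-++ c₀ L₁ L₂) x∈)) ⟩
    Mad (class c₀ L₁ ++ class c₀ L₂) + + 2 / 3 + + 1 / 3
      ≡⟨ +-assoc (Mad (class c₀ L₁ ++ class c₀ L₂)) (+ 2 / 3) (+ 1 / 3) ⟩
    Mad (class c₀ L₁ ++ class c₀ L₂) + 1ℚ
      ≡⟨ cong (λ G → Mad G + 1ℚ) (class-++ c₀ L₁ L₂) ⟨
    remaining c₀ + 1ℚ
      ∎

isolateEdge-step : ∀ {k n} {L : ColouredEdges k n} → k ℕ.< n C 2 → IsPartition L →
                   ∃[ L′ ] (IsPartition L′ × value L + + 1 / 3 ≤ value L′)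
isolateEdge-step {L = L} k<nC2 L-part
  with ∃-large-class L (subst (_ ℕ.<_) (sym (length-partition L-part)) k<nC2)
... | c₀ , 2≤
  with ∃-cheap-edge (class-⊆edgesK L-part c₀) (proj₂ (nonempty⇒∈ (class c₀ L) (ℕ.≤-trans (s≤s z≤n) 2≤)))
...   | e , e∈ , cheap with ∈-∃++ (∈-class⁻ {c = c₀} {L = L} e∈)
...     | L₁ , L₂ , refl =
  isolateEdge L₁ e L₂ , isolateEdge-isPartition L-part remainder , isolateEdge-value {L₁ = L₁} cheap remainder
  where
  remainder : ∃[ x ] x ∈ class c₀ (L₁ ++ L₂)
  remainder = class-remainder L₁ e c₀ L₂ 2≤

proposition2p2 : (n k : ℕ) → 1 ℕ.≤ n → 1 ℕ.≤ k →
    ((k ℕ.≤ n C 2 → M k n + 1ℚ ≤ M k (suc n)) ×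
     (k ℕ.< n C 2 → M k n + (+ 1 / 3) ≤ M (suc k) n))
proposition2p2 (suc n) (suc k) _ _ =
  (λ k≤nC2 → M-improve {suc k} {suc n} {suc k} {suc (suc n)} 1ℚ
               (partition-exists k≤nC2) coneExtension-step) ,
  (λ k<nC2 → M-improve {suc k} {suc n} {suc (suc k)} {suc n} (+ 1 / 3)
               (partition-exists (ℕ.<⇒≤ k<nC2)) (isolateEdge-step k<nC2))
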